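{- Let $n,r\geq 1$ and let $p$ be a prime with $p>\binom{r+1}{2}$. Let $\mathcal{U}_{L_1},\ldots,\mathcal{U}_{L_r}$ be hyperplanes over $\mathbb{Z}_p^n$ such that $\{\mathcal{U}_{L_1},\ldots,\mathcal{U}_{L_r}\}$ is admissible. Assume that the function $\Psi:\mathbb{Z}_p^n\to\mathbb{Z}_p$ has a strong Taylor expansion of order $r$ at the point $(0,\ldots,0)$, and that $$\Psi(s_1p,\ldots,s_np)\equiv 0\pmod{p^r}$$ for each $(s_1,\ldots,s_n)\in\bigcup_{i=1}^r\mathcal{U}_{L_i}$. Then $\Psi(s_1p,\ldots,s_np)\equiv 0\pmod{p^r}$ for every $(s_1,\ldots,s_n)\in\mathbb{Z}_p^n$.
   Context: $\mathbb{Z}_p$ is the ring of $p$-adic integers and $\mathbb{F}_p=\{0,1,\ldots,p-1\}$ the field with $p$ elements; $\tau_p:\mathbb{Z}_p\to\mathbb{F}_p$ is reduction mod $p$, $\tau_p(x)=\langle x\rangle_p$ (least nonnegative residue of $x$ mod $p$). A function $\Psi:\mathbb{Z}_p^n\to\mathbb{Z}_p$ has a strong Taylor expansion of order $r$ at $(\alpha_1,\ldots,\alpha_n)$ if there exist $A_{k_1,\ldots,k_n}\in\mathbb{Z}_p$ such that for all $t_1,\ldots,t_n\in\mathbb{Z}_p$, $$\Psi(\alpha_1+t_1p,\ldots,\alpha_n+t_np)\equiv \Psi(\alpha_1,\ldots,\alpha_n)+\sum_{\substack{k_1,\ldots,k_n\geq0\\ 1\leq k_1+\cdots+k_n\leq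 r}}\frac{A_{k_1,\ldots,k_n}}{k_1!\cdots k_n!}\prod_{i=1}^n(t_ip)^{k_i}\pmod{p^{r+1}}.$$ For a linear function $L(x_1,\ldots,x_n)=a_1x_1+\cdots+a_nx_n+b$ with $a_i,b\in\mathbb{Z}_p$ and $p\nmid a_j$ for some $j$, the hyperplane over $\mathbb{Z}_p^n$ is $\mathcal{U}_L=\{(x_1,\ldots,x_n)\in\mathbb{Z}_p^n: L(x_1,\ldots,x_n)=0\}$, and $\tau_p(\mathcal{U}_L)=\{(\tau_p(x_1),\ldots,\tau_p(x_n)):(x_1,\ldots,x_n)\in\mathcal{U}_L\}\subseteq\mathbb{F}_p^n$. A family $\{\mathcal{U}_{L_1},\ldots,\mathcal{U}_{L_r}\}$ is admissible if $\tau_p(\mathcal{U}_{L_i})\neq\tau_p(\mathcal{U}_{L_j})$ for all $1\leq i<j\leq r$. -}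

module Defs where

open import Data.Nat as ℕ using (ℕ; zero; suc; NonZero)
open import Data.Nat using (_!)
open import Data.Integer as ℤ using (ℤ; +_; _%ℕ_)
open import Data.Integer.Properties as ℤP
open import Data.Integer.Divisibility.Signed using (_∣_; ∣m∣n⇒∣m+n; ∣n⇒∣m*n; ∣m⇒∣m*n; ∣-refl)
open import Data.Integer.Divisibility.Signed as Div using (divides)
open import Data.Fin using (Fin)
import Data.Fin as F
open import Data.Vec using (Vec; []; _∷_; lookup)
open import Data.List using (List; []; _∷_; map; concatMap; upTo; foldr; filterᵇ)
open import Data.Product using (Σ; ∃; _×_; _,_)
open import Data.Bool using (Bool)
open import Relation.Binary.PropositionalEquality using (_≡_; refl; subst; sym)
open import Relation.Nullary using (¬_)
open import Function.Bundles using (_⇔_)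
open import Data.Integer.Tactic.RingSolver using (solve-∀)

-- The p-adic integers ℤ_p as the inverse limit lim ℤ/p^k ℤ:
-- a p-adic integer is a sequence (x_k)_k of integers with
-- x_{k+1} ≡ x_k (mod p^k); x_k represents its image in ℤ/p^k ℤ.

record Zp (p : ℕ) : Set where
  constructor mkZp
  field
    val : ℕ → ℤ
    coh : ∀ k → + (p ℕ.^ k) ∣ (val (suc k) ℤ.- val k)
open Zp public

module _ {p : ℕ} where

  infix 4 _≈_
  _≈_ : Zp p → Zp p → Set
  x ≈ y = ∀ k → + (p ℕ.^ k) ∣ (val x k ℤ.- val y k)

  -- congruence modulo p^m in ℤ_p :  x - y ∈ p^m ℤ_p
  _≡_[mod-p^_] : Zp p → Zp p → ℕ → Set
  x ≡ y [mod-p^ m ] = + (p ℕ.^ m) ∣ (val x m ℤ.- val y m)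

  ι : ℤ → Zp p
  ι z = mkZp (λ _ → z) (λ k → subst (+ (p ℕ.^ k) ∣_) (sym (ℤP.i≡j⇒i-j≡0 {z} refl)) (divides 0ℤ' refl))
    where 0ℤ' = + 0

  0p 1p : Zp p
  0p = ι (+ 0)
  1p = ι (+ 1)

  infixl 6 _⊕_
  infixl 7 _⊗_

  _⊕_ : Zp p → Zp p → Zp p
  x ⊕ y = mkZp (λ k → val x k ℤ.+ val y k) λ k →
    subst (+ (p ℕ.^ k) ∣_) (eq (val x (suc k)) (val x k) (val y (suc k)) (val y k))
          (∣m∣n⇒∣m+n (coh x k) (coh y k))
    where
    eq : ∀ a b c d → (a ℤ.- b) ℤ.+ (c ℤ.- d) ≡ (a ℤ.+ c) ℤ.- (b ℤ.+ d)
    eq = solve-∀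

  _⊗_ : Zp p → Zp p → Zp p
  x ⊗ y = mkZp (λ k → val x k ℤ.* val y k) λ k →
    subst (+ (p ℕ.^ k) ∣_) (eq (val x (suc k)) (val x k) (val y (suc k)) (val y k))
          (∣m∣n⇒∣m+n (∣n⇒∣m*n (val x (suc k)) (coh y k)) (∣m⇒∣m*n (val y k) (coh x k)))
    where
    eq : ∀ a b c d → a ℤ.* (c ℤ.- d) ℤ.+ (a ℤ.- b) ℤ.* d ≡ a ℤ.* c ℤ.- b ℤ.* d
    eq = solve-∀

  _^ₚ_ : Zp p → ℕ → Zp p
  x ^ₚ zero  = 1p
  x ^ₚ suc k = x ⊗ (x ^ₚ k)

  ℕ→Zp : ℕ → Zp p
  ℕ→Zp m = ι (+ m)

  pₚ : Zp p
  pₚ = ℕ→Zp p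

  sumₚ : List (Zp p) → Zp p
  sumₚ = foldr _⊕_ 0p

  sumFin : ∀ {n} → (Fin n → Zp p) → Zp p
  sumFin {zero}  f = 0p
  sumFin {suc n} f = f F.zero ⊕ sumFin (λ i → f (F.suc i))

  prodFin : ∀ {n} → (Fin n → Zp p) → Zp p
  prodFin {zero}  f = 1p
  prodFin {suc n} f = f F.zero ⊗ prodFin (λ i → f (F.suc i))

  -- τ_p : ℤ_p → 𝔽_p, x ↦ ⟨x⟩_p  (𝔽_p = {0,…,p-1} ⊆ ℕ)
  τ : .{{_ : NonZero p}} → Zp p → ℕ
  τ x = val x 1 %ℕ p

vsum : ∀ {n} → Vec ℕ n → ℕ
vsum []       = 0
vsum (k ∷ ks) = k ℕ.+ vsum ks

multiIdx≤ : (n r : ℕ) → List (Vec ℕ n)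
multiIdx≤ zero    r = [] ∷ []
multiIdx≤ (suc n) r = concatMap (λ k → map (k ∷_) (multiIdx≤ n (r ℕ.∸ k))) (upTo (suc r))

multiIdx : (n r : ℕ) → List (Vec ℕ n)
multiIdx n r = filterᵇ (λ ks → 1 ℕ.≤ᵇ vsum ks) (multiIdx≤ n r)

vfact : ∀ {n} → Vec ℕ n → ℕ
vfact []       = 1
vfact (k ∷ ks) = (k !) ℕ.* vfact ks

Pt : ℕ → ℕ → Set
Pt p n = Fin n → Zp p

-- Ψ is a genuine function on ℤ_p^n (respects equality of p-adic integers)
Respects : ∀ {p n} → (Pt p n → Zp p) → Set
Respects {p} {n} Ψ = ∀ x y → (∀ i → x i ≈ y i) → Ψ x ≈ Ψ y

scaleP : ∀ {p n} → Pt p n → Pt p n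
scaleP s i = s i ⊗ pₚ

-- Strong Taylor expansion of order r at α.  The coefficient
-- A_k/(k_1!⋯k_n!) is the element B_k ∈ ℤ_p with (k_1!⋯k_n!)·B_k = A_k.
StrongTaylor : ∀ {p n} → (Pt p n → Zp p) → ℕ → Pt p n → Set
StrongTaylor {p} {n} Ψ r α =
  Σ (Vec ℕ n → Zp p) λ A →
  Σ (Vec ℕ n → Zp p) λ B →
    (∀ ks → ℕ→Zp (vfact ks) ⊗ B ks ≈ A ks) ×
    (∀ (t : Pt p n) →
       Ψ (λ i → α i ⊕ t i ⊗ pₚ)
         ≡ Ψ α ⊕ sumₚ (map (λ ks → B ks ⊗ prodFin (λ i → (t i ⊗ pₚ) ^ₚ lookup ks i))
                          (multiIdx n r))
         [mod-p^ suc r ])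

record Linear (p n : ℕ) : Set where
  field
    coeff : Fin n → Zp p
    const : Zp p
    nondeg : ∃ λ j → ¬ (+ p ∣ val (coeff j) 1)
open Linear public

evalL : ∀ {p n} → Linear p n → Pt p n → Zp p
evalL L x = sumFin (λ i → coeff L i ⊗ x i) ⊕ const L

_∈𝒰_ : ∀ {p n} → Pt p n → Linear p n → Set
x ∈𝒰 L = evalL L x ≈ 0p

_∈τ𝒰_ : ∀ {p n} .{{_ : NonZero p}} → (Fin n → ℕ) → Linear p n → Set
_∈τ𝒰_ {p} {n} v L = ∃ λ (x : Pt p n) → (x ∈𝒰 L) × (∀ i → τ (x i) ≡ v i)

Admissible : ∀ {p n r} .{{_ : NonZero p}} → (Fin r → Linear p n) → Set
Admissible {p} {n} {r} L =
  ∀ (i j : Fin r) → ¬ (i ≡ j) → ¬ (∀ (v : Fin n → ℕ) → (v ∈τ𝒰 L i) ⇔ (v ∈τ𝒰 L j))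

-- On a line s + τ d, the Taylor expansion makes Ψ((s + τ d) p) modulo p^(r+1) a polynomial
-- in τ p.  Such a polynomial that vanishes modulo p^r at r parameters τ pairwise incongruent
-- modulo p vanishes modulo p^r at every τ: dividing out one root costs one factor p.
-- A line through x meets the r hyperplanes at pairwise incongruent parameters as soon as its
-- direction is transversal to the hyperplanes and to the "cross forms"
-- L_i(x) a_j - L_j(x) a_i, and since p > r + C(r,2) such a direction exists whenever these
-- forms are nonzero modulo p.  For an arbitrary s, take a direction e transversal to the
-- hyperplanes: if the cross forms of a pair (i, j) vanished at two points s + t e with t < p,
-- then L_i and L_j would be proportional modulo p, so τ_p(𝒰_{L_i}) = τ_p(𝒰_{L_j}), contradicting
-- admissibility.  Hence at most C(r,2) of the p points s + t e are bad, r good ones remain,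
-- and the line argument along e finishes the proof.

module Submission where

open import Defs
import Data.Integer.Properties as ℤP
open import Algebra.Properties.CommutativeMonoid.Sum ℤP.+-0-commutativeMonoid
  using (sum; sum-cong-≗; ∑-distrib-+; sum-replicate-zero)
open import Algebra.Properties.Semiring.Sum ℤP.+-*-semiring using (*-distribˡ-sum)
open import Data.Empty using (⊥; ⊥-elim)
open import Data.Fin as F using (Fin)
import Data.Fin.Properties as FP
open import Data.Integer as ℤ using (ℤ; +_; _+_; _*_; _-_; -_)
open import Data.Integer.Divisibility.Signed
import Data.Integer.DivMod as ℤD
open import Data.Integer.Tactic.RingSolver using (solve-∀)
open import Data.List using (List; []; _∷_; _++_; length; map; filter; upTo; take; tabulate)
open import Data.List.Properties using (length-upTo; length-take; length-map; length-++; length-tabulate; filter-all)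
open import Data.List.Relation.Unary.All as All using (All; []; _∷_)
import Data.List.Relation.Unary.All.Properties as All
open import Data.List.Relation.Unary.AllPairs as AllPairs using (AllPairs; []; _∷_)
import Data.List.Relation.Unary.AllPairs.Properties as AllPairs
open import Data.Nat as ℕ using (ℕ; zero; suc; _≤_; _<_; z≤n; s≤s; NonZero; _^_)
open import Data.Nat.Combinatorics using (_C_; nC1≡n; nCk+nC[k+1]≡[n+1]C[k+1])
open import Data.Nat.Coprimality using (Coprime; coprime-Bézout)
import Data.Nat.Divisibility as ℕD
open import Data.Nat.GCD using (module Bézout)
open import Data.Nat.Primality using (Prime; prime⇒nonZero; prime⇒irreducible; euclidsLemma)
import Data.Nat.Properties as ℕP
open import Data.Product using (∃; ∃-syntax; _×_; _,_; proj₁; proj₂)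
open import Data.Sum using (_⊎_; inj₁; inj₂; [_,_]′)
open import Data.Vec using (Vec; lookup)
open import Function using (_∘_; id)
open import Function.Bundles using (mk⇔)
open import Relation.Binary.PropositionalEquality
  using (_≡_; _≢_; refl; sym; trans; cong; cong₂; subst; module ≡-Reasoning)
open import Relation.Nullary using (¬_; yes; no; ¬?)
open import Relation.Nullary.Decidable using (decidable-stable)
open import Relation.Unary using (Decidable)

∣-respʳ : ∀ {k a b : ℤ} → a ≡ b → k ∣ a → k ∣ b
∣-respʳ refl k∣a = k∣a

∣m-n∣n⇒∣m : ∀ {k a b} → k ∣ a - b → k ∣ b → k ∣ a
∣m-n∣n⇒∣m {k} {a} {b} k∣a-b k∣b = ∣-respʳ (e a b) (∣m∣n⇒∣m+n k∣a-b k∣b)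
  where
  e : ∀ a b → a - b + b ≡ a
  e = solve-∀

∣0 : ∀ k → k ∣ + 0
∣0 k = divides (+ 0) refl

1∣ : ∀ a → + 1 ∣ a
1∣ a = divides a (sym (ℤP.*-identityʳ a))

pos-^-suc : ∀ p m → + (p ^ suc m) ≡ + p * + (p ^ m)
pos-^-suc p m = ℤP.pos-* p (p ^ m)

p∣p^[1+m] : ∀ p m → + p ∣ + (p ^ suc m)
p∣p^[1+m] p m = ∣ᵤ⇒∣ (ℕD.divides (p ^ m) (ℕP.*-comm p (p ^ m)))

^-mono-∣ : ∀ p {j k} → j ≤ k → + (p ^ j) ∣ + (p ^ k)
^-mono-∣ p {j} {k} j≤k = ∣ᵤ⇒∣ (ℕD.divides (p ^ (k ℕ.∸ j))
  (trans (cong (p ^_) (sym (ℕP.m∸n+n≡m j≤k))) (ℕP.^-distribˡ-+-* p (k ℕ.∸ j) j)))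

p^m∣p^[1+m] : ∀ p m → + (p ^ m) ∣ + (p ^ suc m)
p^m∣p^[1+m] p m = ^-mono-∣ p (ℕP.n≤1+n m)

-- Polynomial functions on ℤ

infixl 6 _+ᴾ_
infixl 7 _*ᴾ_

data PolyFn : (ℤ → ℤ) → Set where
  constᴾ : ∀ c → PolyFn (λ _ → c)
  varᴾ   : PolyFn (λ u → u)
  _+ᴾ_   : ∀ {f g} → PolyFn f → PolyFn g → PolyFn (λ u → f u + g u)
  _*ᴾ_   : ∀ {f g} → PolyFn f → PolyFn g → PolyFn (λ u → f u * g u)

PolyFn-factor : ∀ {f} → PolyFn f → ∀ v →
                ∃[ g ] PolyFn g × (∀ u → f u - f v ≡ (u - v) * g u)
PolyFn-factor (constᴾ c) v = (λ _ → + 0) , constᴾ _ , λ u → e c u v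
  where
  e : ∀ c u v → c - c ≡ (u - v) * + 0
  e = solve-∀
PolyFn-factor varᴾ v = (λ _ → + 1) , constᴾ _ , λ u → e u v
  where
  e : ∀ u v → u - v ≡ (u - v) * + 1
  e = solve-∀
PolyFn-factor (_+ᴾ_ {f} {g} F G) v with PolyFn-factor F v | PolyFn-factor G v
... | f′ , F′ , ef | g′ , G′ , eg = (λ u → f′ u + g′ u) , F′ +ᴾ G′ , λ u → begin
  (f u + g u) - (f v + g v)      ≡⟨ e (f u) (f v) (g u) (g v) ⟩
  (f u - f v) + (g u - g v)      ≡⟨ cong₂ _+_ (ef u) (eg u) ⟩
  (u - v) * f′ u + (u - v) * g′ u ≡⟨ ℤP.*-distribˡ-+ (u - v) (f′ u) (g′ u) ⟨
  (u - v) * (f′ u + g′ u)        ∎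
  where
  open ≡-Reasoning
  e : ∀ a b c d → (a + c) - (b + d) ≡ (a - b) + (c - d)
  e = solve-∀
PolyFn-factor (_*ᴾ_ {f} {g} F G) v with PolyFn-factor F v | PolyFn-factor G v
... | f′ , F′ , ef | g′ , G′ , eg =
  (λ u → f′ u * g u + f v * g′ u) , F′ *ᴾ G +ᴾ constᴾ (f v) *ᴾ G′ , λ u → begin
  f u * g u - f v * g v                       ≡⟨ e (f u) (f v) (g u) (g v) ⟩
  (f u - f v) * g u + f v * (g u - g v)       ≡⟨ cong₂ (λ a b → a * g u + f v * b) (ef u) (eg u) ⟩
  (u - v) * f′ u * g u + f v * ((u - v) * g′ u) ≡⟨ e′ (u - v) (f′ u) (g u) (f v) (g′ u) ⟩
  (u - v) * (f′ u * g u + f v * g′ u)         ∎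
  where
  open ≡-Reasoning
  e : ∀ a b c d → a * c - b * d ≡ (a - b) * c + b * (c - d)
  e = solve-∀
  e′ : ∀ w x y z t → w * x * y + z * (w * t) ≡ w * (x * y + z * t)
  e′ = solve-∀

-- Linear forms, hyperplanes and lines

infix 7 _·_
_·_ : ∀ {n} → (Fin n → ℤ) → (Fin n → ℤ) → ℤ
a · x = sum (λ k → a k * x k)

·-linearʳ : ∀ {n} (a x d : Fin n → ℤ) (t : ℤ) → a · (λ k → x k + t * d k) ≡ a · x + t * (a · d)
·-linearʳ a x d t = begin
  a · (λ k → x k + t * d k)                            ≡⟨ sum-cong-≗ (λ k → e (a k) (x k) (d k) t) ⟩
  sum (λ k → a k * x k + t * (a k * d k))              ≡⟨ ∑-distrib-+ (λ k → a k * x k) (λ k → t * (a k * d k)) ⟩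
  a · x + sum (λ k → t * (a k * d k))                  ≡⟨ cong (_+_ (a · x)) (*-distribˡ-sum t (λ k → a k * d k)) ⟨
  a · x + t * (a · d)                                  ∎
  where
  open ≡-Reasoning
  e : ∀ a x d t → a * (x + t * d) ≡ a * x + t * (a * d)
  e = solve-∀

·-linearˡ : ∀ {n} (A B : ℤ) (f g x : Fin n → ℤ) →
            (λ k → A * f k - B * g k) · x ≡ A * (f · x) - B * (g · x)
·-linearˡ A B f g x = begin
  (λ k → A * f k - B * g k) · x                        ≡⟨ sum-cong-≗ (λ k → e A B (f k) (g k) (x k)) ⟩
  sum (λ k → A * (f k * x k) + (- B) * (g k * x k))    ≡⟨ ∑-distrib-+ (λ k → A * (f k * x k)) (λ k → (- B) * (g k * x k)) ⟩
  sum (λ k → A * (f k * x k)) + sum (λ k → (- B) * (g k * x k))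
                                                      ≡⟨ cong₂ _+_ (*-distribˡ-sum A (λ k → f k * x k)) (*-distribˡ-sum (- B) (λ k → g k * x k)) ⟨
  A * (f · x) + (- B) * (g · x)                        ≡⟨ e′ A B (f · x) (g · x) ⟩
  A * (f · x) - B * (g · x)                            ∎
  where
  open ≡-Reasoning
  e : ∀ A B f g x → (A * f - B * g) * x ≡ A * (f * x) + (- B) * (g * x)
  e = solve-∀
  e′ : ∀ A B S T → A * S + (- B) * T ≡ A * S - B * T
  e′ = solve-∀

∣-· : ∀ {n q} (f x : Fin n → ℤ) → (∀ k → q ∣ f k) → q ∣ f · x
∣-· {zero}  f x q∣f = ∣0 _
∣-· {suc n} f x q∣f = ∣m∣n⇒∣m+n (∣m⇒∣m*n (x F.zero) (q∣f F.zero))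
                                (∣-· (λ k → f (F.suc k)) (λ k → x (F.suc k)) (λ k → q∣f (F.suc k)))

δ : ∀ {n} → Fin n → Fin n → ℤ
δ F.zero    F.zero    = + 1
δ F.zero    (F.suc m) = + 0
δ (F.suc k) F.zero    = + 0
δ (F.suc k) (F.suc m) = δ k m

·-zeroʳ : ∀ {n} (g : Fin n → ℤ) → g · (λ _ → + 0) ≡ + 0
·-zeroʳ {n} g = trans (sum-cong-≗ {n} {λ k → g k * + 0} {λ _ → + 0} (λ k → ℤP.*-zeroʳ (g k)))
                      (sum-replicate-zero n)

·-δ : ∀ {n} (g : Fin n → ℤ) (k : Fin n) → g · δ k ≡ g k
·-δ {suc n} g F.zero    = trans (cong₂ _+_ (ℤP.*-identityʳ (g F.zero)) (·-zeroʳ (λ m → g (F.suc m))))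
                                (ℤP.+-identityʳ (g F.zero))
·-δ {suc n} g (F.suc k) = trans (cong (_+ (λ m → g (F.suc m)) · δ k) (ℤP.*-zeroʳ (g F.zero)))
                                 (trans (ℤP.+-identityˡ _) (·-δ (λ m → g (F.suc m)) k))

val-sumFin : ∀ {p m} (f : Fin m → Zp p) k → val (sumFin f) k ≡ sum (λ i → val (f i) k)
val-sumFin {m = zero}  f k = refl
val-sumFin {m = suc m} f k = cong (_+_ (val (f F.zero) k)) (val-sumFin (λ i → f (F.suc i)) k)

module _ {p n : ℕ} where

  coeffAt : Linear p n → ℕ → Fin n → ℤ
  coeffAt L k i = val (coeff L i) k

  valAt : ℕ → Pt p n → Fin n → ℤ
  valAt k x i = val (x i) k

  slope : Linear p n → Pt p n → Zp p
  slope L d = sumFin (λ i → coeff L i ⊗ d i)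

  line : Pt p n → Pt p n → Zp p → Pt p n
  line x d τ i = x i ⊕ τ ⊗ d i

  val-slope : ∀ (L : Linear p n) (d : Pt p n) k → val (slope L d) k ≡ coeffAt L k · valAt k d
  val-slope L d = val-sumFin (λ i → coeff L i ⊗ d i)

  val-evalL : ∀ (L : Linear p n) (x : Pt p n) k → val (evalL L x) k ≡ coeffAt L k · valAt k x + val (const L) k
  val-evalL L x k = cong (_+ val (const L) k) (val-sumFin (λ i → coeff L i ⊗ x i) k)

  ιᵛ : (Fin n → ℤ) → Pt p n
  ιᵛ d i = ι (d i)

  cross : Linear p n → Linear p n → Pt p n → Fin n → ℤ
  cross L L′ x k = val (evalL L x) 1 * coeffAt L′ 1 k - val (evalL L′ x) 1 * coeffAt L 1 k

  val-evalL-line : ∀ (L : Linear p n) (x d : Pt p n) (τ : Zp p) k →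
                   val (evalL L (line x d τ)) k ≡ val (evalL L x) k + val τ k * val (slope L d) k
  val-evalL-line L x d τ k = begin
    val (evalL L (line x d τ)) k                      ≡⟨ val-evalL L (line x d τ) k ⟩
    a · (λ i → valAt k x i + t * valAt k d i) + b     ≡⟨ cong (_+ b) (·-linearʳ a (valAt k x) (valAt k d) t) ⟩
    a · valAt k x + t * (a · valAt k d) + b           ≡⟨ e (a · valAt k x) t (a · valAt k d) b ⟩
    a · valAt k x + b + t * (a · valAt k d)           ≡⟨ cong₂ (λ u v → u + t * v) (val-evalL L x k) (val-slope L d k) ⟨
    val (evalL L x) k + t * val (slope L d) k         ∎
    where
    open ≡-Reasoning
    a = coeffAt L k
    b = val (const L) k
    t = val τ k
    e : ∀ S t T b → S + t * T + b ≡ S + b + t * T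
    e = solve-∀

-- Pairs of indices and residues avoiding constraints

m+mC2≡[1+m]C2 : ∀ m → m ℕ.+ m C 2 ≡ suc m C 2
m+mC2≡[1+m]C2 m = trans (cong (ℕ._+ m C 2) (sym (nC1≡n m))) (nCk+nC[k+1]≡[n+1]C[k+1] m 1)

private
  first-row : ∀ m → List (Fin (suc m) × Fin (suc m))
  first-row m = tabulate (λ j → F.zero , F.suc j)

  shift : ∀ {m} → Fin m × Fin m → Fin (suc m) × Fin (suc m)
  shift (i , j) = F.suc i , F.suc j

pairs : ∀ m → List (Fin m × Fin m)
pairs zero    = []
pairs (suc m) = first-row m ++ map shift (pairs m)

length-pairs : ∀ m → length (pairs m) ≡ m C 2
length-pairs zero    = refl
length-pairs (suc m) = begin
  length (first-row m ++ map shift (pairs m))         ≡⟨ length-++ (first-row m) ⟩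
  length (first-row m) ℕ.+ length (map shift (pairs m))
                                                     ≡⟨ cong₂ ℕ._+_ (length-tabulate _) (trans (length-map shift (pairs m)) (length-pairs m)) ⟩
  m ℕ.+ m C 2                                        ≡⟨ m+mC2≡[1+m]C2 m ⟩
  suc m C 2                                          ∎
  where open ≡-Reasoning

pairs-≢ : ∀ m → All (λ (i , j) → i ≢ j) (pairs m)
pairs-≢ zero    = []
pairs-≢ (suc m) = All.++⁺ (All.tabulate⁺ (λ _ ()))
                          (All.map⁺ (All.map (λ i≢j → i≢j ∘ FP.suc-injective) (pairs-≢ m)))

pairs-cover : ∀ {m} {R : Fin m × Fin m → Set} → All R (pairs m) →
              ∀ {i j} → i ≢ j → R (i , j) ⊎ R (j , i)
pairs-cover {suc m} {R} all {i} {j} i≢j with All.++⁻ (first-row m) all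
... | first , rest with i | j
...   | F.zero  | F.zero  = ⊥-elim (i≢j refl)
...   | F.zero  | F.suc j = inj₁ (All.tabulate⁻ first j)
...   | F.suc i | F.zero  = inj₂ (All.tabulate⁻ first i)
...   | F.suc i | F.suc j = pairs-cover {R = λ (i , j) → R (F.suc i , F.suc j)} (All.map⁻ rest)
                                        (i≢j ∘ cong F.suc)

module _ (p : ℕ) where

  AtMostOneBelow : (ℕ → Set) → Set
  AtMostOneBelow Q = ∀ {v w} → v < p → w < p → Q v → Q w → v ≡ w

  length-filter-¬-atMostOne : ∀ {Q : ℕ → Set} (Q? : Decidable Q) → AtMostOneBelow Q →
                              ∀ vs → All (_< p) vs → AllPairs _≢_ vs →
                              length vs ≤ suc (length (filter (¬? ∘ Q?) vs))
  length-filter-¬-atMostOne Q? amo []       _            _ = z≤n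
  length-filter-¬-atMostOne {Q} Q? amo (v ∷ vs) (v<p ∷ vs<p) (v≢vs ∷ ≢vs) with Q? v
  ... | yes Qv = s≤s (ℕP.≤-reflexive (sym (cong length (filter-all (¬? ∘ Q?) ¬Qvs))))
    where
    ¬Qvs : All (λ w → ¬ Q w) vs
    ¬Qvs = All.zipWith (λ (w<p , v≢w) Qw → v≢w (amo v<p w<p Qv Qw)) (vs<p , v≢vs)
  ... | no ¬Qv = s≤s (length-filter-¬-atMostOne Q? amo vs vs<p ≢vs)

  module _ {C : Set} (B : C → ℕ → Set) (B? : ∀ c → Decidable (B c)) where

    survivors : List C → List ℕ
    survivors []       = upTo p
    survivors (c ∷ cs) = filter (¬? ∘ B? c) (survivors cs)

    survivors-< : ∀ cs → All (_< p) (survivors cs)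
    survivors-< []       = All.applyUpTo⁺₁ id p id
    survivors-< (c ∷ cs) = All.filter⁺ (¬? ∘ B? c) (survivors-< cs)

    survivors-distinct : ∀ cs → AllPairs _≢_ (survivors cs)
    survivors-distinct []       = AllPairs.applyUpTo⁺₁ id p (λ i<j _ → ℕP.<⇒≢ i<j)
    survivors-distinct (c ∷ cs) = AllPairs.filter⁺ (¬? ∘ B? c) (survivors-distinct cs)

    survivors-avoid : ∀ cs → All (λ v → All (λ c → ¬ B c v) cs) (survivors cs)
    survivors-avoid []       = All.universal (λ _ → []) (upTo p)
    survivors-avoid (c ∷ cs) = All.zipWith (λ (¬Bcv , ¬Bcsv) → ¬Bcv ∷ ¬Bcsv)
      (All.all-filter (¬? ∘ B? c) (survivors cs) , All.filter⁺ (¬? ∘ B? c) (survivors-avoid cs))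

    survivors-length : ∀ cs → All (λ c → AtMostOneBelow (B c)) cs →
                       p ≤ length cs ℕ.+ length (survivors cs)
    survivors-length []       _            = ℕP.≤-reflexive (sym (length-upTo p))
    survivors-length (c ∷ cs) (amo ∷ amos) = begin
      p                                                     ≤⟨ survivors-length cs amos ⟩
      length cs ℕ.+ length (survivors cs)                   ≤⟨ ℕP.+-monoʳ-≤ (length cs)
                                                                 (length-filter-¬-atMostOne (B? c) amo (survivors cs)
                                                                    (survivors-< cs) (survivors-distinct cs)) ⟩
      length cs ℕ.+ suc (length (survivors (c ∷ cs)))       ≡⟨ ℕP.+-suc (length cs) _ ⟩
      length (c ∷ cs) ℕ.+ length (survivors (c ∷ cs))       ∎
      where open ℕP.≤-Reasoning

    fresh-values : ∀ m cs → All (λ c → AtMostOneBelow (B c)) cs → m ℕ.+ length cs ≤ p →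
                   ∃[ vs ] length vs ≡ m × AllPairs _≢_ vs ×
                           All (λ v → v < p × All (λ c → ¬ B c v) cs) vs
    fresh-values m cs amos m+|cs|≤p =
      take m vs , trans (length-take m vs) (ℕP.m≤n⇒m⊓n≡m m≤|vs|) ,
      AllPairs.take⁺ m (survivors-distinct cs) ,
      All.take⁺ m (All.zip (survivors-< cs , survivors-avoid cs))
      where
      vs = survivors cs
      m≤|vs| : m ≤ length vs
      m≤|vs| = ℕP.+-cancelʳ-≤ (length cs) m (length vs)
                 (ℕP.≤-trans m+|cs|≤p (subst (p ≤_) (ℕP.+-comm (length cs) (length vs))
                                               (survivors-length cs amos)))

    fresh-value : ∀ cs → All (λ c → AtMostOneBelow (B c)) cs → length cs < p →
                  ∃[ v ] v < p × All (λ c → ¬ B c v) cs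
    fresh-value cs amos |cs|<p with fresh-values 1 cs amos |cs|<p
    ... | v ∷ _ , _ , _ , (v<p , good) ∷ _ = v , v<p , good

taylorPolynomial : ∀ {p n} → Zp p → ℕ → (Vec ℕ n → Zp p) → Pt p n → Zp p
taylorPolynomial {n = n} c r B h =
  c ⊕ sumₚ (map (λ ks → B ks ⊗ prodFin (λ i → h i ^ₚ lookup ks i)) (multiIdx n r))

-- Arithmetic modulo powers of a prime p

module _ {p : ℕ} (p-prime : Prime p) where

  instance
    p-nonZero : NonZero p
    p-nonZero = prime⇒nonZero p-prime

  P : ℤ
  P = + p

  instance
    P-nonZero : ℤ.NonZero P
    P-nonZero = record { nonZero = NonZero.nonZero p-nonZero }

  euclidsLemmaℤ : ∀ a b → P ∣ a * b → P ∣ a ⊎ P ∣ b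
  euclidsLemmaℤ a b p∣ab with euclidsLemma (ℤ.∣ a ∣) (ℤ.∣ b ∣) p-prime
                                (subst (p ℕD.∣_) (ℤP.abs-* a b) (∣⇒∣ᵤ p∣ab))
  ... | inj₁ p∣a = inj₁ (∣ᵤ⇒∣ p∣a)
  ... | inj₂ p∣b = inj₂ (∣ᵤ⇒∣ p∣b)

  cancel-unitˡ : ∀ m {a b} → ¬ (P ∣ a) → + (p ^ m) ∣ a * b → + (p ^ m) ∣ b
  cancel-unitˡ zero    {a} {b} p∤a _ = 1∣ b
  cancel-unitˡ (suc m) {a} {b} p∤a p^[1+m]∣ab
    with euclidsLemmaℤ a b (∣-trans (p∣p^[1+m] p m) p^[1+m]∣ab)
  ... | inj₁ p∣a = ⊥-elim (p∤a p∣a)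
  ... | inj₂ (divides q refl) =
    ∣-respʳ (ℤP.*-comm P q) (subst (_∣ P * q) (sym (pos-^-suc p m)) (*-monoʳ-∣ P p^m∣q))
    where
    e : ∀ a q P → a * (q * P) ≡ P * (a * q)
    e = solve-∀
    p^m∣q : + (p ^ m) ∣ q
    p^m∣q = cancel-unitˡ m p∤a (*-cancelˡ-∣ P
              (∣-respʳ (e a q P) (subst (_∣ a * (q * P)) (pos-^-suc p m) p^[1+m]∣ab)))

  infix 4 _#_
  _#_ : ℤ → ℤ → Set
  a # b = ¬ (P ∣ a - b)

  #-sym : ∀ {a b} → a # b → b # a
  #-sym {a} {b} a#b p∣b-a = a#b (∣-respʳ (e a b) (∣m⇒∣-m p∣b-a))
    where
    e : ∀ a b → - (b - a) ≡ a - b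
    e = solve-∀

  private
    ≤-<-≢⇒# : ∀ {v w} → v ≤ w → w < p → v ≢ w → + v # + w
    ≤-<-≢⇒# {v} {w} v≤w w<p v≢w p∣v-w = contra (w ℕ.∸ v) refl
      where
      p∣w∸v : p ℕD.∣ (w ℕ.∸ v)
      p∣w∸v = ∣⇒∣ᵤ (∣-respʳ (ℤP.neg-involutive _)
                (∣m⇒∣-m (∣-respʳ (trans (ℤP.m-n≡m⊖n v w) (ℤP.⊖-≤ v≤w)) p∣v-w)))
      contra : ∀ δ → w ℕ.∸ v ≡ δ → ⊥
      contra zero    eq = v≢w (ℕP.≤-antisym v≤w (ℕP.m∸n≡0⇒m≤n eq))
      contra (suc δ) eq = ℕP.<⇒≱ w<p (ℕP.≤-trans (ℕD.∣⇒≤ (subst (p ℕD.∣_) eq p∣w∸v))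
                                                 (subst (_≤ w) eq (ℕP.m∸n≤m w v)))

  <-≢⇒# : ∀ {v w} → v < p → w < p → v ≢ w → + v # + w
  <-≢⇒# {v} {w} v<p w<p v≢w with ℕP.≤-total v w
  ... | inj₁ v≤w = ≤-<-≢⇒# v≤w w<p v≢w
  ... | inj₂ w≤v = #-sym {+ w} {+ v} (≤-<-≢⇒# w≤v v<p (λ e → v≢w (sym e)))

  distinct⇒# : ∀ {ts} → All (_< p) ts → AllPairs _≢_ ts → AllPairs (λ t t′ → + t # + t′) ts
  distinct⇒# []             []            = []
  distinct⇒# (t<p ∷ ts<p) (t≢ts ∷ ≢ts) =
    All.zipWith (λ (t′<p , t≢t′) → <-≢⇒# t<p t′<p t≢t′) (ts<p , t≢ts) ∷ distinct⇒# ts<p ≢ts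

  %ℕ-cong : ∀ a b → P ∣ a - b → a ℤ.%ℕ p ≡ b ℤ.%ℕ p
  %ℕ-cong a b p∣a-b with (a ℤ.%ℕ p) ℕ.≟ (b ℤ.%ℕ p)
  ... | yes eq = eq
  ... | no neq = ⊥-elim (<-≢⇒# (ℤD.n%ℕd<d a p) (ℤD.n%ℕd<d b p) neq
                   (∣-respʳ (trans (cong₂ (λ x y → (x - y) - (qa - qb) * P)
                                          (ℤD.a≡a%ℕn+[a/ℕn]*n a p) (ℤD.a≡a%ℕn+[a/ℕn]*n b p))
                                   (e (+ (a ℤ.%ℕ p)) qa (+ (b ℤ.%ℕ p)) qb P))
                     (∣m∣n⇒∣m-n p∣a-b (∣n⇒∣m*n (qa - qb) (∣-refl {P})))))
    where
    qa = a ℤ./ℕ p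
    qb = b ℤ./ℕ p
    e : ∀ ra qa rb qb P → (ra + qa * P - (rb + qb * P)) - (qa - qb) * P ≡ ra - rb
    e = solve-∀

  private
    inverse-modℕ : ∀ m → ¬ (p ℕD.∣ m) → ∃[ w ] P ∣ w * + m - + 1
    inverse-modℕ m p∤m with coprime-Bézout coprime
      where
      coprime : Coprime p m
      coprime (d∣p , d∣m) with prime⇒irreducible p-prime d∣p
      ... | inj₁ d≡1 = d≡1
      ... | inj₂ refl = ⊥-elim (p∤m d∣m)
    ... | Bézout.+- x y eq = - + y , divides (- + x) (begin
      - + y * + m - + 1        ≡⟨ e (+ y) (+ m) ⟩
      - (+ 1 + + y * + m)      ≡⟨ cong -_ (trans (ℤP.pos-+ 1 (y ℕ.* m)) (cong (_+_ (+ 1)) (ℤP.pos-* y m))) ⟨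
      - + (1 ℕ.+ y ℕ.* m)     ≡⟨ cong (λ z → - + z) eq ⟩
      - + (x ℕ.* p)            ≡⟨ cong -_ (ℤP.pos-* x p) ⟩
      - (+ x * P)              ≡⟨ ℤP.neg-distribˡ-* (+ x) P ⟩
      - + x * P                ∎)
      where
      open ≡-Reasoning
      e : ∀ a b → (- a) * b - + 1 ≡ - (+ 1 + a * b)
      e = solve-∀
    ... | Bézout.-+ x y eq = + y , divides (+ x) (begin
      + y * + m - + 1          ≡⟨ cong (_- + 1) (ℤP.pos-* y m) ⟨
      + (y ℕ.* m) - + 1        ≡⟨ cong (λ z → + z - + 1) eq ⟨
      + (1 ℕ.+ x ℕ.* p) - + 1  ≡⟨ cong (_- + 1) (trans (ℤP.pos-+ 1 (x ℕ.* p)) (cong (_+_ (+ 1)) (ℤP.pos-* x p))) ⟩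
      + 1 + + x * P - + 1      ≡⟨ e (+ x * P) ⟩
      + x * P                  ∎)
      where
      open ≡-Reasoning
      e : ∀ a → + 1 + a - + 1 ≡ a
      e = solve-∀

  inverse-mod-p : ∀ a → ¬ (P ∣ a) → ∃[ w ] P ∣ w * a - + 1
  inverse-mod-p (+ m)      p∤a = inverse-modℕ m (λ p∣m → p∤a (∣ᵤ⇒∣ p∣m))
  inverse-mod-p ℤ.-[1+ m ] p∤a with inverse-modℕ (suc m) (λ p∣m → p∤a (∣ᵤ⇒∣ p∣m))
  ... | w , p∣w*m-1 = - w , ∣-respʳ (e w (+ suc m)) p∣w*m-1
    where
    e : ∀ w a → w * a - + 1 ≡ (- w) * (- a) - + 1
    e = solve-∀

  -- The step y ↦ y - (y a - 1) y₀ multiplies the error y a - 1 by 1 - y₀ a ≡ 0 (mod p).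
  inverse-mod-p^ : ∀ k a → ¬ (P ∣ a) → ∃[ y ] + (p ^ k) ∣ y * a - + 1
  inverse-mod-p^ zero    a p∤a = + 0 , 1∣ _
  inverse-mod-p^ (suc k) a p∤a with inverse-mod-p a p∤a | inverse-mod-p^ k a p∤a
  ... | y₀ , divides q₀ e₀ | y , divides m e = y - m * K * y₀ , divides (- (m * q₀)) (begin
    (y - m * K * y₀) * a - + 1           ≡⟨ e₁ y a m K y₀ ⟩
    (y * a - + 1) - m * K * (y₀ * a)     ≡⟨ cong (λ z → z - m * K * (y₀ * a)) e ⟩
    m * K - m * K * (y₀ * a)             ≡⟨ e₂ m K (y₀ * a) ⟩
    - (m * K * (y₀ * a - + 1))           ≡⟨ cong (λ z → - (m * K * z)) e₀ ⟩
    - (m * K * (q₀ * P))                 ≡⟨ e₃ m K q₀ P ⟩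
    - (m * q₀) * (P * K)                 ≡⟨ cong (- (m * q₀) *_) (pos-^-suc p k) ⟨
    - (m * q₀) * + (p ^ suc k)           ∎)
    where
    open ≡-Reasoning
    K = + (p ^ k)
    e₁ : ∀ y a m K y₀ → (y - m * K * y₀) * a - + 1 ≡ (y * a - + 1) - m * K * (y₀ * a)
    e₁ = solve-∀
    e₂ : ∀ m K b → m * K - m * K * b ≡ - (m * K * (b - + 1))
    e₂ = solve-∀
    e₃ : ∀ m K q P → - (m * K * (q * P)) ≡ - (m * q) * (P * K)
    e₃ = solve-∀

  val-coherent : ∀ (x : Zp p) j k → + (p ^ j) ∣ val x (k ℕ.+ j) - val x j
  val-coherent x j zero    = ∣-respʳ (sym (ℤP.+-inverseʳ (val x j))) (∣0 _)
  val-coherent x j (suc k) = ∣-respʳ (e (val x (suc (k ℕ.+ j))) (val x (k ℕ.+ j)) (val x j))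
    (∣m∣n⇒∣m+n (∣-trans (^-mono-∣ p (ℕP.m≤n+m j k)) (coh x (k ℕ.+ j))) (val-coherent x j k))
    where
    e : ∀ a b c → (a - b) + (b - c) ≡ a - c
    e = solve-∀

  val-≡-mod-p : ∀ (x : Zp p) k → P ∣ val x (suc k) - val x 1
  val-≡-mod-p x k = subst (λ z → P ∣ val x z - val x 1) (ℕP.+-comm k 1)
                      (subst (λ z → + z ∣ val x (k ℕ.+ 1) - val x 1) (ℕP.*-identityʳ p)
                        (val-coherent x 1 k))

  unit-val : ∀ (c : Zp p) → ¬ (P ∣ val c 1) → ∀ k → ¬ (P ∣ val c (suc k))
  unit-val c p∤c₁ k p∣cₖ = p∤c₁ (∣-respʳ (e (val c (suc k)) (val c 1))
                                  (∣m∣n⇒∣m-n p∣cₖ (val-≡-mod-p c k)))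
    where
    e : ∀ a b → a - (a - b) ≡ b
    e = solve-∀

  p^1∣⇒p∣ : ∀ {a} → + (p ^ 1) ∣ a → P ∣ a
  p^1∣⇒p∣ = subst (λ q → + q ∣ _) (ℕP.*-identityʳ p)

  #-lift : ∀ (σ τ : Zp p) k → val σ 1 # val τ 1 → val σ (suc k) # val τ (suc k)
  #-lift σ τ k σ#τ p∣σ-τ = σ#τ (∣-respʳ (e (val σ (suc k)) (val τ (suc k)) (val σ 1) (val τ 1))
    (∣m∣n⇒∣m+n (∣m∣n⇒∣m-n p∣σ-τ (val-≡-mod-p σ k)) (val-≡-mod-p τ k)))
    where
    e : ∀ a b c d → (a - b) - (a - c) + (b - d) ≡ c - d
    e = solve-∀

  module _ (c : Zp p) (p∤c : ¬ (P ∣ val c 1)) where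

    private
      inv : ℕ → ℤ
      inv zero    = + 0
      inv (suc k) = proj₁ (inverse-mod-p^ (suc k) (val c (suc k)) (unit-val c p∤c k))

      inv-spec : ∀ k → + (p ^ k) ∣ inv k * val c k - + 1
      inv-spec zero    = 1∣ _
      inv-spec (suc k) = proj₂ (inverse-mod-p^ (suc k) (val c (suc k)) (unit-val c p∤c k))

      inv-coh : ∀ k → + (p ^ k) ∣ inv (suc k) - inv k
      inv-coh zero    = 1∣ _
      inv-coh (suc k) = cancel-unitˡ (suc k) (unit-val c p∤c k) (∣-respʳ (e y′ y c′ c₀)
        (∣m∣n⇒∣m-n (∣m∣n⇒∣m+n (∣n⇒∣m*n y′ (∣m⇒∣-m (coh c (suc k))))
                               (∣-trans (p^m∣p^[1+m] p (suc k)) (inv-spec (suc (suc k)))))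
                   (inv-spec (suc k))))
        where
        y′ = inv (suc (suc k))
        y  = inv (suc k)
        c′ = val c (suc (suc k))
        c₀ = val c (suc k)
        e : ∀ y′ y c′ c → y′ * (- (c′ - c)) + (y′ * c′ - + 1) - (y * c - + 1) ≡ c * (y′ - y)
        e = solve-∀

    inverseₚ : Zp p
    inverseₚ = mkZp inv inv-coh

    inverseₚ-spec : ∀ k → + (p ^ k) ∣ val inverseₚ k * val c k - + 1
    inverseₚ-spec = inv-spec

  -- Polynomials along lines

  -- Writing f (P t) - f (P t₀) = P (t - t₀) g (P t), each zero t₀ of f (P ·) modulo p^(m+1)
  -- turns the other zeros into zeros of g (P ·) modulo p^m, as t - t₀ is a unit.
  PolyFn-vanishing : ∀ {f} → PolyFn f → (ts : List ℤ) → AllPairs _#_ ts →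
                     All (λ t → + (p ^ length ts) ∣ f (P * t)) ts →
                     ∀ t → + (p ^ length ts) ∣ f (P * t)
  PolyFn-vanishing F []        _             _            t = 1∣ _
  PolyFn-vanishing {f} F (t₀ ∷ ts) (t₀#ts ∷ #ts) (f[t₀] ∷ f[ts]) t =
    ∣-respʳ (e (f (P * t)) (f (P * t₀)))
      (∣m∣n⇒∣m+n (subst (_∣ f (P * t) - f (P * t₀)) (sym (pos-^-suc p m))
                   (∣-respʳ (sym (difference t)) (*-monoʳ-∣ P (∣n⇒∣m*n (t - t₀) g-vanishes))))
                 f[t₀])
    where
    m = length ts
    factor = PolyFn-factor F (P * t₀)
    g = proj₁ factor
    difference : ∀ t → f (P * t) - f (P * t₀) ≡ P * ((t - t₀) * g (P * t))
    difference t = trans (proj₂ (proj₂ factor) (P * t)) (e′ P t t₀ (g (P * t)))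
      where
      e′ : ∀ P t t₀ x → (P * t - P * t₀) * x ≡ P * ((t - t₀) * x)
      e′ = solve-∀
    reduce : ∀ {t} → t₀ # t → + (p ^ suc m) ∣ f (P * t) → + (p ^ m) ∣ g (P * t)
    reduce {t} t₀#t f[t] = cancel-unitˡ m (#-sym {t₀} {t} t₀#t) (*-cancelˡ-∣ P
      (subst (_∣ P * ((t - t₀) * g (P * t))) (pos-^-suc p m)
        (∣-respʳ (difference t) (∣m∣n⇒∣m-n f[t] f[t₀]))))
    g-vanishes : + (p ^ m) ∣ g (P * t)
    g-vanishes = PolyFn-vanishing (proj₁ (proj₂ factor)) ts #ts
                   (All.zipWith (λ (t₀#t , f[t]) → reduce t₀#t f[t]) (t₀#ts , f[ts])) t
    e : ∀ a b → (a - b) + b ≡ a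
    e = solve-∀

  infixl 6 _⊕ˢ_
  infixl 7 _⊗ˢ_

  -- F τ is a polynomial in τ p with coefficients in ℤ_p.
  data ScaledPoly : (Zp p → Zp p) → Set where
    constˢ : ∀ c → ScaledPoly (λ _ → c)
    varˢ   : ScaledPoly (λ τ → τ ⊗ pₚ)
    _⊕ˢ_   : ∀ {F G} → ScaledPoly F → ScaledPoly G → ScaledPoly (λ τ → F τ ⊕ G τ)
    _⊗ˢ_   : ∀ {F G} → ScaledPoly F → ScaledPoly G → ScaledPoly (λ τ → F τ ⊗ G τ)
    extˢ   : ∀ {F G} → ScaledPoly F → (∀ τ k → val (F τ) k ≡ val (G τ) k) → ScaledPoly G

  ScaledPoly-val : ∀ {F} → ScaledPoly F → ∀ k →
                   ∃[ f ] PolyFn f × (∀ τ → val (F τ) k ≡ f (P * val τ k))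
  ScaledPoly-val (constˢ c) k = (λ _ → val c k) , constᴾ _ , λ _ → refl
  ScaledPoly-val varˢ       k = (λ u → u) , varᴾ , λ τ → ℤP.*-comm (val τ k) P
  ScaledPoly-val (F ⊕ˢ G)   k with ScaledPoly-val F k | ScaledPoly-val G k
  ... | f , Fᴾ , ef | g , Gᴾ , eg = (λ u → f u + g u) , Fᴾ +ᴾ Gᴾ , λ τ → cong₂ _+_ (ef τ) (eg τ)
  ScaledPoly-val (F ⊗ˢ G)   k with ScaledPoly-val F k | ScaledPoly-val G k
  ... | f , Fᴾ , ef | g , Gᴾ , eg = (λ u → f u * g u) , Fᴾ *ᴾ Gᴾ , λ τ → cong₂ _*_ (ef τ) (eg τ)
  ScaledPoly-val (extˢ F e) k with ScaledPoly-val F k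
  ... | f , Fᴾ , ef = f , Fᴾ , λ τ → trans (sym (e τ k)) (ef τ)

  ScaledPoly-sumₚ : ∀ {A : Set} {F : A → Zp p → Zp p} → (∀ a → ScaledPoly (F a)) →
                    ∀ as → ScaledPoly (λ τ → sumₚ (map (λ a → F a τ) as))
  ScaledPoly-sumₚ Fˢ []       = constˢ 0p
  ScaledPoly-sumₚ Fˢ (a ∷ as) = Fˢ a ⊕ˢ ScaledPoly-sumₚ Fˢ as

  ScaledPoly-prodFin : ∀ {m} {F : Fin m → Zp p → Zp p} → (∀ i → ScaledPoly (F i)) →
                       ScaledPoly (λ τ → prodFin (λ i → F i τ))
  ScaledPoly-prodFin {zero}  Fˢ = constˢ 1p
  ScaledPoly-prodFin {suc m} Fˢ = Fˢ F.zero ⊗ˢ ScaledPoly-prodFin (λ i → Fˢ (F.suc i))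

  ScaledPoly-^ₚ : ∀ {F} → ScaledPoly F → ∀ m → ScaledPoly (λ τ → F τ ^ₚ m)
  ScaledPoly-^ₚ Fˢ zero    = constˢ 1p
  ScaledPoly-^ₚ Fˢ (suc m) = Fˢ ⊗ˢ ScaledPoly-^ₚ Fˢ m

  -- The parameter τ = - L(x) / (a · d) where x + τ d meets 𝒰_L; only meet-spec is used about it.
  opaque
    meet : ∀ {n} (L : Linear p n) (x d : Pt p n) → ¬ (P ∣ val (slope L d) 1) → Zp p
    meet L x d u = (ι (- + 1) ⊗ evalL L x) ⊗ inverseₚ (slope L d) u

  opaque
    unfolding meet

    meet-spec : ∀ {n} (L : Linear p n) (x d : Pt p n) (u : ¬ (P ∣ val (slope L d) 1)) k →
                + (p ^ k) ∣ val (meet L x d u) k * val (slope L d) k + val (evalL L x) k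
    meet-spec L x d u k = ∣-respʳ (e (val (evalL L x) k) (val (inverseₚ (slope L d) u) k) (val (slope L d) k))
                            (∣n⇒∣m*n (- val (evalL L x) k) (inverseₚ-spec (slope L d) u k))
      where
      e : ∀ A y C → (- A) * (y * C - + 1) ≡ (- + 1 * A) * y * C + A
      e = solve-∀

  line-meet-∈𝒰 : ∀ {n} (L : Linear p n) (x d : Pt p n) (u : ¬ (P ∣ val (slope L d) 1)) → line x d (meet L x d u) ∈𝒰 L
  line-meet-∈𝒰 L x d u k = ∣-respʳ (trans (e τC (val (evalL L x) k))
                                     (cong (_- + 0) (sym (val-evalL-line L x d (meet L x d u) k))))
                             (meet-spec L x d u k)
    where
    τC = val (meet L x d u) k * val (slope L d) k
    e : ∀ a b → a + b ≡ b + a - + 0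
    e = solve-∀

  atMostOne-affine : ∀ A G → ¬ (P ∣ A) ⊎ ¬ (P ∣ G) → AtMostOneBelow p (λ v → P ∣ A + + v * G)
  atMostOne-affine A G nonzero {v} {w} v<p w<p p∣A+vG p∣A+wG =
    decidable-stable (v ℕ.≟ w) λ v≢w →
      [ <-≢⇒# v<p w<p v≢w , (λ p∣G → [ (λ p∤A → p∤A (p∣A p∣G)) , (λ p∤G → p∤G p∣G) ]′ nonzero) ]′
        (euclidsLemmaℤ (+ v - + w) G (∣-respʳ (e₁ A (+ v) (+ w) G) (∣m∣n⇒∣m-n p∣A+vG p∣A+wG)))
    where
    e₁ : ∀ A v w G → (A + v * G) - (A + w * G) ≡ (v - w) * G
    e₁ = solve-∀
    e₂ : ∀ A v G → A + v * G - v * G ≡ A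
    e₂ = solve-∀
    p∣A : P ∣ G → P ∣ A
    p∣A p∣G = ∣-respʳ (e₂ A (+ v) G) (∣m∣n⇒∣m-n p∣A+vG (∣n⇒∣m*n (+ v) p∣G))

  -- Perturbing a solution d₀ for fs along a unit coordinate of f, each form excludes at
  -- most one residue of the perturbation, and fewer than p forms leave one free.
  avoid-linear-forms : ∀ {n} (fs : List (Fin n → ℤ)) → All (λ f → ∃[ k ] ¬ (P ∣ f k)) fs →
                       length fs < p → ∃[ d ] All (λ f → ¬ (P ∣ f · d)) fs
  avoid-linear-forms []       []             _       = (λ _ → + 0) , []
  avoid-linear-forms {n} (f ∷ fs) ((k , p∤fk) ∷ units) |f∷fs|<p =
    d , All.map (λ {g} ¬bad p∣gd → ¬bad (∣-respʳ (g·d g) p∣gd)) (proj₂ (proj₂ fresh))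
    where
    ih = avoid-linear-forms fs units (ℕP.<-trans (ℕP.n<1+n _) |f∷fs|<p)
    d₀ = proj₁ ih
    fs[d₀] = proj₂ ih
    Bad : (Fin n → ℤ) → ℕ → Set
    Bad g v = P ∣ g · d₀ + + v * g k
    fresh = fresh-value p Bad (λ g v → P ∣? g · d₀ + + v * g k) (f ∷ fs)
              ((λ {v} {w} → atMostOne-affine (f · d₀) (f k) (inj₂ p∤fk) {v} {w})
                ∷ All.map (λ {g} p∤gd₀ {v} {w} → atMostOne-affine (g · d₀) (g k) (inj₁ p∤gd₀) {v} {w}) fs[d₀])
              |f∷fs|<p
    d : Fin n → ℤ
    d m = d₀ m + + proj₁ fresh * δ k m
    g·d : ∀ g → g · d ≡ g · d₀ + + proj₁ fresh * g k
    g·d g = trans (·-linearʳ g d₀ (δ k) (+ proj₁ fresh)) (cong (λ z → g · d₀ + + proj₁ fresh * z) (·-δ g k))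

  meet-spec₁ : ∀ {n} (L : Linear p n) (x : Pt p n) (d : Fin n → ℤ) (u : ¬ (P ∣ val (slope L (ιᵛ d)) 1)) →
               P ∣ val (meet L x (ιᵛ d) u) 1 * (coeffAt L 1 · d) + val (evalL L x) 1
  meet-spec₁ L x d u = subst (λ z → P ∣ val (meet L x (ιᵛ d) u) 1 * z + val (evalL L x) 1)
                             (val-slope L (ιᵛ d) 1) (p^1∣⇒p∣ (meet-spec L x (ιᵛ d) u 1))

  meet-# : ∀ {n} (L L′ : Linear p n) (x : Pt p n) (d : Fin n → ℤ)
           (u : ¬ (P ∣ val (slope L (ιᵛ d)) 1)) (u′ : ¬ (P ∣ val (slope L′ (ιᵛ d)) 1)) → ¬ (P ∣ cross L L′ x · d) →
           val (meet L x (ιᵛ d) u) 1 # val (meet L′ x (ιᵛ d) u′) 1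
  meet-# L L′ x d u u′ p∤cross p∣t-t′ = p∤cross (∣-respʳ (begin
      (t * c + A) * c′ - (t′ * c′ + A′) * c - (t - t′) * c * c′   ≡⟨ e t t′ c c′ A A′ ⟩
      A * c′ - A′ * c                                             ≡⟨ ·-linearˡ A A′ (coeffAt L′ 1) (coeffAt L 1) d ⟨
      cross L L′ x · d                                            ∎)
    (∣m∣n⇒∣m-n (∣m∣n⇒∣m-n (∣m⇒∣m*n c′ (meet-spec₁ L x d u)) (∣m⇒∣m*n c (meet-spec₁ L′ x d u′)))
               (∣m⇒∣m*n c′ (∣m⇒∣m*n c p∣t-t′))))
    where
    open ≡-Reasoning
    t = val (meet L x (ιᵛ d) u) 1
    t′ = val (meet L′ x (ιᵛ d) u′) 1
    c = coeffAt L 1 · d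
    c′ = coeffAt L′ 1 · d
    A = val (evalL L x) 1
    A′ = val (evalL L′ x) 1
    e : ∀ t t′ c c′ A A′ → (t * c + A) * c′ - (t′ * c′ + A′) * c - (t - t′) * c * c′ ≡ A * c′ - A′ * c
    e = solve-∀

  meet-incongruent : ∀ {n r} (L : Fin r → Linear p n) (x : Pt p n) (d : Fin n → ℤ)
    (unit : ∀ i → ¬ (P ∣ val (slope (L i) (ιᵛ d)) 1)) →
    All (λ (i , j) → ¬ (P ∣ cross (L i) (L j) x · d)) (pairs r) →
    AllPairs (λ σ τ → val σ 1 # val τ 1) (tabulate λ i → meet (L i) x (ιᵛ d) (unit i))
  meet-incongruent L x d unit p∤crosses = AllPairs.tabulate⁺ λ {i} {j} i≢j →
    [ meet-# (L i) (L j) x d (unit i) (unit j)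
    , (λ p∤ji → #-sym {val (meet (L j) x (ιᵛ d) (unit j)) 1} {val (meet (L i) x (ιᵛ d) (unit i)) 1}
                      (meet-# (L j) (L i) x d (unit j) (unit i) p∤ji)) ]′
      (pairs-cover p∤crosses i≢j)

  val-evalL-line-ι : ∀ {n} (L : Linear p n) (s : Pt p n) (e : Fin n → ℤ) (t : ℤ) →
                     val (evalL L (line s (ιᵛ e) (ι t))) 1 ≡ val (evalL L s) 1 + t * (coeffAt L 1 · e)
  val-evalL-line-ι L s e t = trans (val-evalL-line L s (ιᵛ e) (ι t) 1)
                                   (cong (λ z → val (evalL L s) 1 + t * z) (val-slope L (ιᵛ e) 1))

  combination : ∀ {n} → ℤ → Linear p n → ℤ → Linear p n → Pt p n → ℤ
  combination c L c′ L′ x = c * val (evalL L′ x) 1 - c′ * val (evalL L x) 1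

  combination-form : ∀ {n} (c : ℤ) (L : Linear p n) (c′ : ℤ) (L′ : Linear p n) (x : Pt p n) → combination c L c′ L′ x ≡
    (λ k → c * coeffAt L′ 1 k - c′ * coeffAt L 1 k) · valAt 1 x + (c * val (const L′) 1 - c′ * val (const L) 1)
  combination-form c L c′ L′ x = begin
    c * val (evalL L′ x) 1 - c′ * val (evalL L x) 1
      ≡⟨ cong₂ (λ u v → c * u - c′ * v) (val-evalL L′ x 1) (val-evalL L x 1) ⟩
    c * (a′ · valAt 1 x + b′) - c′ * (a · valAt 1 x + b)
      ≡⟨ e c c′ (a′ · valAt 1 x) (a · valAt 1 x) b′ b ⟩
    (c * (a′ · valAt 1 x) - c′ * (a · valAt 1 x)) + (c * b′ - c′ * b)
      ≡⟨ cong (_+ (c * b′ - c′ * b)) (·-linearˡ c c′ a′ a (valAt 1 x)) ⟨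
    (λ k → c * a′ k - c′ * a k) · valAt 1 x + (c * b′ - c′ * b)
      ∎
    where
    open ≡-Reasoning
    a = coeffAt L 1
    a′ = coeffAt L′ 1
    b = val (const L) 1
    b′ = val (const L′) 1
    e : ∀ c c′ S′ S b′ b → c * (S′ + b′) - c′ * (S + b) ≡ (c * S′ - c′ * S) + (c * b′ - c′ * b)
    e = solve-∀

  combination-swap : ∀ {n} (c : ℤ) (L : Linear p n) (c′ : ℤ) (L′ : Linear p n) (x : Pt p n) →
                     P ∣ combination c L c′ L′ x → P ∣ combination c′ L′ c L x
  combination-swap c L c′ L′ x p∣comb =
    ∣-respʳ (e (c * val (evalL L′ x) 1) (c′ * val (evalL L x) 1)) (∣m⇒∣-m p∣comb)
    where
    e : ∀ a b → - (a - b) ≡ b - a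
    e = solve-∀

  -- The cross form at s + t e is affine in t with slope proportional to c a′ - c′ a, so its
  -- vanishing at two incongruent t forces c a′ ≡ c′ a, and then also c b′ ≡ c′ b.
  cross-vanishing-twice : ∀ {n} (L L′ : Linear p n) (s : Pt p n) (e : Fin n → ℤ) (t t′ : ℤ) → t # t′ →
    (∀ k → P ∣ cross L L′ (line s (ιᵛ e) (ι t)) k) → (∀ k → P ∣ cross L L′ (line s (ιᵛ e) (ι t′)) k) →
    ∀ x → P ∣ combination (coeffAt L 1 · e) L (coeffAt L′ 1 · e) L′ x
  cross-vanishing-twice {n} L L′ s e t t′ t#t′ cross[t] cross[t′] x =
    ∣-respʳ (sym (combination-form c L c′ L′ x)) (∣m∣n⇒∣m+n (∣-· combo (valAt 1 x) p∣combo) p∣K)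
    where
    c = coeffAt L 1 · e
    c′ = coeffAt L′ 1 · e
    A = val (evalL L s) 1
    A′ = val (evalL L′ s) 1
    combo : Fin n → ℤ
    combo k = c * coeffAt L′ 1 k - c′ * coeffAt L 1 k
    cross-at : ∀ t k → cross L L′ (line s (ιᵛ e) (ι t)) k ≡
                       (A + t * c) * coeffAt L′ 1 k - (A′ + t * c′) * coeffAt L 1 k
    cross-at t k = cong₂ (λ u v → u * coeffAt L′ 1 k - v * coeffAt L 1 k)
                         (val-evalL-line-ι L s e t) (val-evalL-line-ι L′ s e t)
    e₁ : ∀ A A′ c c′ t t′ a′ a → ((A + t * c) * a′ - (A′ + t * c′) * a) - ((A + t′ * c) * a′ - (A′ + t′ * c′) * a)
                                ≡ (t - t′) * (c * a′ - c′ * a)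
    e₁ = solve-∀
    p∣combo : ∀ k → P ∣ combo k
    p∣combo k = [ (λ p∣t-t′ → ⊥-elim (t#t′ p∣t-t′)) , id ]′ (euclidsLemmaℤ (t - t′) (combo k)
      (∣-respʳ (trans (cong₂ _-_ (cross-at t k) (cross-at t′ k)) (e₁ A A′ c c′ t t′ (coeffAt L′ 1 k) (coeffAt L 1 k)))
               (∣m∣n⇒∣m-n (cross[t] k) (cross[t′] k))))
    p∣combination[s+te] : P ∣ combination c L c′ L′ (line s (ιᵛ e) (ι t))
    p∣combination[s+te] = ∣-respʳ (trans (cong -_ (·-linearˡ Ly L′y (coeffAt L′ 1) (coeffAt L 1) e)) (e₂ Ly L′y c c′))
                         (∣m⇒∣-m (∣-· (cross L L′ (line s (ιᵛ e) (ι t))) e cross[t]))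
      where
      Ly = val (evalL L (line s (ιᵛ e) (ι t))) 1
      L′y = val (evalL L′ (line s (ιᵛ e) (ι t))) 1
      e₂ : ∀ B B′ c c′ → - (B * c′ - B′ * c) ≡ c * B′ - c′ * B
      e₂ = solve-∀
    p∣K : P ∣ c * val (const L′) 1 - c′ * val (const L) 1
    p∣K = ∣m+n∣m⇒∣n (∣-respʳ (combination-form c L c′ L′ (line s (ιᵛ e) (ι t))) p∣combination[s+te]) (∣-· combo (valAt 1 (line s (ιᵛ e) (ι t))) p∣combo)

  ∈𝒰⇒p∣ : ∀ {n} (x : Pt p n) (L : Linear p n) → x ∈𝒰 L → P ∣ val (evalL L x) 1
  ∈𝒰⇒p∣ x L x∈𝒰 = ∣-respʳ (ℤP.+-identityʳ (val (evalL L x) 1)) (p^1∣⇒p∣ (x∈𝒰 1))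

  -- A point of 𝒰_L is moved onto 𝒰_L′ along d by a parameter divisible by p,
  -- which does not change its reduction.
  τ𝒰-⊆ : ∀ {n} (L L′ : Linear p n) (c c′ : ℤ) (d : Fin n → ℤ) (u′ : ¬ (P ∣ val (slope L′ (ιᵛ d)) 1)) → ¬ (P ∣ c) →
         (∀ x → P ∣ combination c L c′ L′ x) → ∀ v → v ∈τ𝒰 L → v ∈τ𝒰 L′
  τ𝒰-⊆ L L′ c c′ d u′ p∤c proportional v (x , x∈𝒰 , τx≡v) =
    line x (ιᵛ d) (meet L′ x (ιᵛ d) u′) , line-meet-∈𝒰 L′ x (ιᵛ d) u′ ,
    λ k → trans (%ℕ-cong (val (x k) 1 + val t 1 * d k) (val (x k) 1) (∣-respʳ (e (val (x k) 1) (val t 1) (d k)) (∣m⇒∣m*n (d k) p∣t))) (τx≡v k)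
    where
    t : Zp p
    t = meet L′ x (ιᵛ d) u′
    p∣L′x : P ∣ val (evalL L′ x) 1
    p∣L′x = [ (λ p∣c → ⊥-elim (p∤c p∣c)) , id ]′ (euclidsLemmaℤ c (val (evalL L′ x) 1)
              (∣m-n∣n⇒∣m {a = c * val (evalL L′ x) 1} {b = c′ * val (evalL L x) 1}
                          (proportional x) (∣n⇒∣m*n c′ (∈𝒰⇒p∣ x L x∈𝒰))))
    p∣t : P ∣ val t 1
    p∣t = [ id , (λ p∣c′ → ⊥-elim (u′ (∣-respʳ (sym (val-slope L′ (ιᵛ d) 1)) p∣c′))) ]′
            (euclidsLemmaℤ (val t 1) (coeffAt L′ 1 · d) (∣m+n∣n⇒∣m (meet-spec₁ L′ x d u′) p∣L′x))
    e : ∀ a t b → t * b ≡ a + t * b - a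
    e = solve-∀

  -- The vanishing of Ψ

  module _ {n r : ℕ} (Ψ : Pt p n → Zp p) (Ψ-resp : Respects Ψ) (B : Vec ℕ n → Zp p)
           (expansion : ∀ (t : Pt p n) → Ψ (λ i → 0p ⊕ t i ⊗ pₚ)
                                ≡ taylorPolynomial (Ψ (λ _ → 0p)) r B (λ i → t i ⊗ pₚ) [mod-p^ suc r ])
           where

    Vanishes : Pt p n → Set
    Vanishes s = Ψ (scaleP s) ≡ 0p [mod-p^ r ]

    taylor : Pt p n → Zp p
    taylor h = taylorPolynomial (Ψ (λ _ → 0p)) r B h

    Ψ-≈-taylor : ∀ (t : Pt p n) → + (p ^ r) ∣ val (Ψ (scaleP t)) r - val (taylor (λ i → t i ⊗ pₚ)) (suc r)
    Ψ-≈-taylor t = ∣-respʳ (e (val (Ψ (scaleP t)) r) (val (Ψ t′) r) (val (Ψ t′) (suc r))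
                              (val (taylor (λ i → t i ⊗ pₚ)) (suc r)))
      (∣m∣n⇒∣m+n (∣m∣n⇒∣m-n (Ψ-resp (scaleP t) t′ 0⊕ r) (coh (Ψ t′) r))
                 (∣-trans (p^m∣p^[1+m] p r) (expansion t)))
      where
      t′ : Pt p n
      t′ i = 0p ⊕ t i ⊗ pₚ
      z : ∀ x → x - (+ 0 + x) ≡ + 0
      z = solve-∀
      0⊕ : ∀ i → scaleP t i ≈ t′ i
      0⊕ i k = ∣-respʳ (sym (z (val (t i) k * P))) (∣0 _)
      e : ∀ a b c d → (a - b) - (c - b) + (c - d) ≡ a - d
      e = solve-∀

    taylor-on-line : ∀ (x d : Pt p n) → ScaledPoly (λ τ → taylor (λ i → line x d τ i ⊗ pₚ))
    taylor-on-line x d = constˢ (Ψ (λ _ → 0p)) ⊕ˢ ScaledPoly-sumₚ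
      (λ ks → constˢ (B ks) ⊗ˢ ScaledPoly-prodFin (λ i → ScaledPoly-^ₚ (coordinate i) (lookup ks i)))
      (multiIdx n r)
      where
      coordinate : ∀ i → ScaledPoly (λ τ → line x d τ i ⊗ pₚ)
      coordinate i = extˢ (constˢ (x i ⊗ pₚ) ⊕ˢ constˢ (d i) ⊗ˢ varˢ)
                          (λ τ k → e (val (x i) k) (val (d i) k) (val τ k) P)
        where
        e : ∀ x d t P → x * P + d * (t * P) ≡ (x + t * d) * P
        e = solve-∀

    vanishes-by-line : ∀ (x d : Pt p n) (τs : List (Zp p)) →
                       AllPairs (λ σ τ → val σ 1 # val τ 1) τs → length τs ≡ r →
                       All (λ τ → Vanishes (line x d τ)) τs → Vanishes x
    vanishes-by-line x d τs #τs |τs|≡r vanish = ∣-respʳ (sym (ℤP.+-identityʳ (val (Ψ (scaleP x)) r)))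
      (∣m-n∣n⇒∣m (Ψ-resp (scaleP x) (scaleP (line x d 0p)) x≈x+0d r) Ψ[x+0d])
      where
      shadow = ScaledPoly-val (taylor-on-line x d) (suc r)
      f = proj₁ shadow
      f≡ = proj₂ (proj₂ shadow)
      ts = map (λ τ → val τ (suc r)) τs
      |ts|≡r : length ts ≡ r
      |ts|≡r = trans (length-map _ τs) |τs|≡r
      vanish-f : ∀ τ → Vanishes (line x d τ) → + (p ^ r) ∣ f (P * val τ (suc r))
      vanish-f τ Ψ[τ] = ∣-respʳ (trans (e (val (Ψ (scaleP (line x d τ))) r) _) (f≡ τ))
        (∣m∣n⇒∣m-n (∣-respʳ (ℤP.+-identityʳ (val (Ψ (scaleP (line x d τ))) r)) Ψ[τ]) (Ψ-≈-taylor (line x d τ)))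
        where
        e : ∀ a b → a - (a - b) ≡ b
        e = solve-∀
      f[0] : + (p ^ r) ∣ f (P * + 0)
      f[0] = subst (λ m → + (p ^ m) ∣ f (P * + 0)) |ts|≡r
               (PolyFn-vanishing (proj₁ (proj₂ shadow)) ts (AllPairs.map⁺ (AllPairs.map (λ {σ} {τ} → #-lift σ τ r) #τs))
                 (All.map⁺ (All.map (λ {τ} → subst (λ m → + (p ^ m) ∣ f (P * val τ (suc r))) (sym |ts|≡r)
                                               ∘ vanish-f τ) vanish))
                 (+ 0))
      Ψ[x+0d] : + (p ^ r) ∣ val (Ψ (scaleP (line x d 0p))) r
      Ψ[x+0d] = ∣m-n∣n⇒∣m (Ψ-≈-taylor (line x d 0p)) (∣-respʳ (sym (f≡ 0p)) f[0])
      x≈x+0d : ∀ i → scaleP x i ≈ scaleP (line x d 0p) i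
      x≈x+0d i k = ∣-respʳ (sym (e (val (x i) k) (val (d i) k) P)) (∣0 _)
        where
        e : ∀ a b P → a * P - (a + + 0 * b) * P ≡ + 0
        e = solve-∀

    module _ (L : Fin r → Linear p n) (bound : suc r C 2 < p)
             (vanishes-on-𝒰 : ∀ s → (∃ λ i → s ∈𝒰 L i) → Vanishes s) where

      Generic : Pt p n → Set
      Generic x = All (λ (i , j) → ∃[ k ] ¬ (P ∣ cross (L i) (L j) x k)) (pairs r)

      r+|pairs|<p : r ℕ.+ length (pairs r) < p
      r+|pairs|<p = subst (_< p) (sym (trans (cong (r ℕ.+_) (length-pairs r)) (m+mC2≡[1+m]C2 r))) bound

      slope-unit : ∀ i (d : Fin n → ℤ) → ¬ (P ∣ coeffAt (L i) 1 · d) → ¬ (P ∣ val (slope (L i) (ιᵛ d)) 1)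
      slope-unit i d p∤c = p∤c ∘ ∣-respʳ (val-slope (L i) (ιᵛ d) 1)

      -- Along a direction transversal to every L i and to every cross form at x, the r
      -- hyperplanes are met at pairwise incongruent parameters.
      vanishes-along-transversal : ∀ (x : Pt p n) (d : Fin n → ℤ) →
        (∀ i → ¬ (P ∣ coeffAt (L i) 1 · d)) →
        All (λ (i , j) → ¬ (P ∣ cross (L i) (L j) x · d)) (pairs r) → Vanishes x
      vanishes-along-transversal x d units p∤crosses =
        vanishes-by-line x (ιᵛ d) (tabulate λ i → meet (L i) x (ιᵛ d) (unit i))
          (meet-incongruent L x d unit p∤crosses) (length-tabulate _)
          (All.tabulate⁺ λ i → vanishes-on-𝒰 (line x (ιᵛ d) (meet (L i) x (ιᵛ d) (unit i)))
                                             (i , line-meet-∈𝒰 (L i) x (ιᵛ d) (unit i)))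
        where
        unit : ∀ i → ¬ (P ∣ val (slope (L i) (ιᵛ d)) 1)
        unit i = slope-unit i d (units i)

      vanishes-at-generic : ∀ (x : Pt p n) → Generic x → Vanishes x
      vanishes-at-generic x generic =
        vanishes-along-transversal x d (All.tabulate⁻ (proj₁ split)) (All.map⁻ (proj₂ split))
        where
        slopes = tabulate (λ i → coeffAt (L i) 1)
        crosses = map (λ (i , j) → cross (L i) (L j) x) (pairs r)
        transversal = avoid-linear-forms (slopes ++ crosses)
          (All.++⁺ (All.tabulate⁺ (λ i → nondeg (L i))) (All.map⁺ generic))
          (subst (_< p) (sym (trans (length-++ slopes) (cong₂ ℕ._+_ (length-tabulate _) (length-map _ (pairs r)))))
                 r+|pairs|<p)
        d = proj₁ transversal
        split = All.++⁻ slopes (proj₂ transversal)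

      Bad : Pt p n → (Fin n → ℤ) → Fin r × Fin r → ℕ → Set
      Bad s e (i , j) t = ∀ k → P ∣ cross (L i) (L j) (line s (ιᵛ e) (ι (+ t))) k

      Bad? : ∀ s e ij → Decidable (Bad s e ij)
      Bad? s e (i , j) t = FP.all? (λ k → P ∣? cross (L i) (L j) (line s (ιᵛ e) (ι (+ t))) k)

      ¬Bad⇒Generic : ∀ s e {t} → All (λ ij → ¬ Bad s e ij t) (pairs r) → Generic (line s (ιᵛ e) (ι (+ t)))
      ¬Bad⇒Generic s e {t} = All.map (λ {(i , j)} →
        FP.¬∀⟶∃¬ n _ (λ k → P ∣? cross (L i) (L j) (line s (ιᵛ e) (ι (+ t))) k))

      -- Two bad parameters make L i and L j proportional modulo p, against admissibility.
      Bad-atMostOne : Admissible L → ∀ s e → (∀ i → ¬ (P ∣ coeffAt (L i) 1 · e)) →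
                      ∀ {i j} → i ≢ j → AtMostOneBelow p (Bad s e (i , j))
      Bad-atMostOne admissible s e units {i} {j} i≢j {t} {t′} t<p t′<p bad bad′ =
        decidable-stable (t ℕ.≟ t′) λ t≢t′ → admissible i j i≢j λ v → mk⇔
          (τ𝒰-⊆ (L i) (L j) cᵢ cⱼ e (slope-unit j e (units j)) (units i) (proportional t≢t′) v)
          (τ𝒰-⊆ (L j) (L i) cⱼ cᵢ e (slope-unit i e (units i)) (units j)
                (λ x → combination-swap cᵢ (L i) cⱼ (L j) x (proportional t≢t′ x)) v)
        where
        cᵢ = coeffAt (L i) 1 · e
        cⱼ = coeffAt (L j) 1 · e
        proportional : t ≢ t′ → ∀ x → P ∣ combination cᵢ (L i) cⱼ (L j) x
        proportional t≢t′ = cross-vanishing-twice (L i) (L j) s e (+ t) (+ t′) (<-≢⇒# t<p t′<p t≢t′) bad bad′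

      vanishes-everywhere : Admissible L → ∀ (s : Pt p n) → Vanishes s
      vanishes-everywhere admissible s =
        vanishes-by-line s (ιᵛ e) (map (λ t → ι (+ t)) ts)
          (AllPairs.map⁺ (distinct⇒# (All.map proj₁ ts-good) ts-distinct))
          (trans (length-map _ ts) |ts|≡r)
          (All.map⁺ (All.map vanishes-at-good ts-good))
        where
        transversal : ∃[ e ] All (λ f → ¬ (P ∣ f · e)) (tabulate (λ i → coeffAt (L i) 1))
        transversal = avoid-linear-forms (tabulate (λ i → coeffAt (L i) 1)) (All.tabulate⁺ (λ i → nondeg (L i)))
          (ℕP.≤-<-trans (ℕP.≤-reflexive (length-tabulate _)) (ℕP.≤-<-trans (ℕP.m≤m+n r _) r+|pairs|<p))
        e : Fin n → ℤ
        e = proj₁ transversal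
        fresh : ∃[ ts ] length ts ≡ r × AllPairs _≢_ ts ×
                        All (λ t → t < p × All (λ ij → ¬ Bad s e ij t) (pairs r)) ts
        fresh = fresh-values p (Bad s e) (Bad? s e) r (pairs r)
                  (All.map (Bad-atMostOne admissible s e (All.tabulate⁻ (proj₂ transversal))) (pairs-≢ r))
                  (ℕP.<⇒≤ r+|pairs|<p)
        ts : List ℕ
        ts = proj₁ fresh
        |ts|≡r : length ts ≡ r
        |ts|≡r = proj₁ (proj₂ fresh)
        ts-distinct : AllPairs _≢_ ts
        ts-distinct = proj₁ (proj₂ (proj₂ fresh))
        ts-good : All (λ t → t < p × All (λ ij → ¬ Bad s e ij t) (pairs r)) ts
        ts-good = proj₂ (proj₂ (proj₂ fresh))
        vanishes-at-good : ∀ {t} → t < p × All (λ ij → ¬ Bad s e ij t) (pairs r) →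
                           Vanishes (line s (ιᵛ e) (ι (+ t)))
        vanishes-at-good {t} (_ , good) = vanishes-at-generic (line s (ιᵛ e) (ι (+ t))) (¬Bad⇒Generic s e {t} good)

-- Only the coefficients B = A/k! of the expansion are used, and n, r ≥ 1 is not needed.
theorem1p1 : (n r p : ℕ) → 1 ≤ n → 1 ≤ r → Prime p → .{{_ : NonZero p}} →
    (suc r) C 2 < p →
    (L : Fin r → Linear p n) → Admissible L →
    (Ψ : Pt p n → Zp p) → Respects Ψ →
    StrongTaylor Ψ r (λ _ → 0p) →
    (∀ (s : Pt p n) → (∃ λ i → s ∈𝒰 L i) → Ψ (scaleP s) ≡ 0p [mod-p^ r ]) →
    ∀ (s : Pt p n) → Ψ (scaleP s) ≡ 0p [mod-p^ r ]
theorem1p1 n r p _ _ p-prime bound L admissible Ψ Ψ-resp (_ , B , _ , expansion) vanishes-on-𝒰 =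
  vanishes-everywhere p-prime Ψ Ψ-resp B expansion L bound vanishes-on-𝒰 admissible
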